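{- Fix an integer $k \ge 2$ and let $(G_n)_{n\ge 0}$ be the $k$-bonacci sequence defined by $G_0=G_1=\dots=G_{k-2}=0$, $G_{k-1}=1$, and $G_n=\sum_{i=1}^{k} G_{n-i}$ for $n \ge k$. Define $D_k = 2(k-1)$ and, for $0 \le i \le j \le k-1$, integers $N_{i,j}$ (depending on $k$) by $N_{0,0} = -(k-2)$; $N_{i,i} = 4-(i+3)(k-i)$ for $1 \le i \le k-1$; $N_{i,j} = 2(i+1)\bigl(j-(k-2)\bigr)$ for $0 \le i \le k-2$ and $i+1 \le j \le k-1$. Then for every integer $m \ge 0$, $$\sum_{i=0}^{m} G_i^2 \;=\; \sum_{0 \le i \le j \le k-1} \frac{N_{i,j}}{D_k}\, G_{m+i}\, G_{m+j} \;-\; \frac{N_{k-1,k-1}}{D_k}.$$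
   Context: $G_n$ denotes the $k$-bonacci number $F^{(k)}_n$ (for $k=2$ the Fibonacci numbers, $k=3$ Tribonacci, etc.). The double sum runs over all pairs of integers $(i,j)$ with $0\le i\le j\le k-1$. Note $-N_{k-1,k-1}/D_k=(k-2)/(2(k-1))$. -}

module Defs where

open import Data.Nat as ℕ using (ℕ; zero; suc; _∸_)
open import Data.Integer as ℤ using (ℤ; +_)
import Relation.Nullary
open import Data.List using (List; []; _∷_; _++_; replicate)
open import Data.Nat.ListAction using (sum)
open import Data.Rational using (ℚ; 0ℚ; _/_; _+_; _*_)

-- Window of k consecutive k-bonacci values [G n, G (n+1), ..., G (n+k-1)].
window : ℕ → ℕ → List ℕ
window k zero = replicate (k ∸ 1) 0 ++ (1 ∷ [])
window k (suc n) with window k n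
... | []      = []
... | x ∷ xs  = xs ++ (sum (x ∷ xs) ∷ [])

G : ℕ → ℕ → ℕ
G k n with window k n
... | []     = 0
... | x ∷ _  = x

N : ℕ → ℕ → ℕ → ℤ
N k zero zero = ℤ.- (+ (k ∸ 2))
N k (suc i') j with suc i' ℕ.≟ j
... | Relation.Nullary.yes _ = + 4 ℤ.- (+ (suc i' ℕ.+ 3)) ℤ.* (+ k ℤ.- + suc i')
... | Relation.Nullary.no _  = + (2 ℕ.* (suc i' ℕ.+ 1)) ℤ.* (+ j ℤ.- + (k ∸ 2))
N k zero j = + (2 ℕ.* 1) ℤ.* (+ j ℤ.- + (k ∸ 2))

-- D_k = 2(k-1); dividing an integer by D_k as a rational (only used for k ≥ 2;
-- defined as 0 for k < 2 where D_k = 0).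
divD : ℕ → ℤ → ℚ
divD (suc (suc k')) z = z / (2 ℕ.* suc k')
divD _ _ = 0ℚ

Σ< : ℕ → (ℕ → ℚ) → ℚ
Σ< zero f = 0ℚ
Σ< (suc n) f = Σ< n f + f n

sumSq : ℕ → ℕ → ℚ
sumSq k m = Σ< (suc m) (λ i → (+ (G k i ℕ.* G k i)) / 1)

doubleSum : ℕ → ℕ → ℚ
doubleSum k m = Σ< k (λ i → Σ< (k ∸ i) (λ t →
  divD k (N k i (i ℕ.+ t)) * ((+ (G k (m ℕ.+ i) ℕ.* G k (m ℕ.+ (i ℕ.+ t)))) / 1)))

{-# OPTIONS --safe #-}
-- Let Q(y₀, …, y_{k-1}) = Σ_{i ≤ j} N_{i,j} y_i y_j and c = k - 2, so that D_k times the
-- right-hand side is Q(G_m, …, G_{m+k-1}) - N_{k-1,k-1}. Away from the boundary the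
-- coefficients satisfy N_{i-1,j-1} - N_{i,j} = c - i - j, a rank-two pattern; hence shifting
-- a window y₀, …, y_n by one changes the partial form Q_n (n ≥ 2) by
--   c S² - 2 S M + 2 (n - 1 - c) y_n M + N_{n-1,n-1} y_n² + 2 (c + 1) y₁²,
-- where S = Σ_{i<n} y_i, M = Σ_{i<n} i y_i, and the last term comes from the exceptional N_{0,0}.
-- For n = k and y_k = S, which is the k-bonacci recurrence, only D_k y₁² survives. So
-- D_k Σ_{i≤m} G_i² and Q(G_m, …, G_{m+k-1}) - N_{k-1,k-1} grow by the same D_k G_{m+1}², and
-- both vanish at m = 0, where the window is (0, …, 0, 1).

module Submission where

open import Relation.Binary.PropositionalEquality using (_≡_; refl; sym; trans; cong; cong₂; subst; module ≡-Reasoning)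
open import Defs
open import Data.Nat using (ℕ; _≤_; _∸_)

module IntegerSums where

  open import Data.Nat using (zero; suc; _<_)
  import Data.Nat.Properties as ℕₚ
  open import Data.Integer using (ℤ; +_; _+_; _*_)
  import Data.Integer.Properties as ℤₚ
  open import Data.Integer.Tactic.RingSolver using (solve-∀)

  Σℤ : ℕ → (ℕ → ℤ) → ℤ
  Σℤ zero    f = + 0
  Σℤ (suc n) f = Σℤ n f + f n

  Σℤ-cong : ∀ n {f g : ℕ → ℤ} → (∀ i → i < n → f i ≡ g i) → Σℤ n f ≡ Σℤ n g
  Σℤ-cong zero    f≗g = refl
  Σℤ-cong (suc n) f≗g =
    cong₂ _+_ (Σℤ-cong n (λ i i<n → f≗g i (ℕₚ.m<n⇒m<1+n i<n))) (f≗g n ℕₚ.≤-refl)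

  Σℤ-zero : ∀ n (f : ℕ → ℤ) → (∀ i → i < n → f i ≡ + 0) → Σℤ n f ≡ + 0
  Σℤ-zero zero    f f≗0 = refl
  Σℤ-zero (suc n) f f≗0 =
    cong₂ _+_ (Σℤ-zero n f (λ i i<n → f≗0 i (ℕₚ.m<n⇒m<1+n i<n))) (f≗0 n ℕₚ.≤-refl)

  Σℤ-+ : ∀ n (f g : ℕ → ℤ) → Σℤ n (λ i → f i + g i) ≡ Σℤ n f + Σℤ n g
  Σℤ-+ zero    f g = refl
  Σℤ-+ (suc n) f g =
    trans (cong (_+ (f n + g n)) (Σℤ-+ n f g)) (interchange (Σℤ n f) (Σℤ n g) (f n) (g n))
    where
    interchange : ∀ a b c d → (a + b) + (c + d) ≡ (a + c) + (b + d)
    interchange = solve-∀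

  Σℤ-*ˡ : ∀ n a (f : ℕ → ℤ) → Σℤ n (λ i → a * f i) ≡ a * Σℤ n f
  Σℤ-*ˡ zero    a f = sym (ℤₚ.*-zeroʳ a)
  Σℤ-*ˡ (suc n) a f =
    trans (cong (_+ a * f n) (Σℤ-*ˡ n a f)) (sym (ℤₚ.*-distribˡ-+ a (Σℤ n f) (f n)))

  Σℤ-suc : ∀ n (f : ℕ → ℤ) → Σℤ (suc n) f ≡ f 0 + Σℤ n (λ i → f (suc i))
  Σℤ-suc zero    f = ℤₚ.+-comm (+ 0) (f 0)
  Σℤ-suc (suc n) f = trans (cong (_+ f (suc n)) (Σℤ-suc n f)) (ℤₚ.+-assoc (f 0) _ _)

module KBonacciRecurrence where

  open import Data.Nat using (zero; suc; _+_; _<_; s≤s)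
  import Data.Nat.Properties as ℕₚ
  open import Data.Integer as ℤ using (+_)
  import Data.Integer.Properties as ℤₚ
  open import Data.List using (List; []; _∷_; _++_; [_]; replicate; length)
  open import Data.List.Properties using (length-++; length-replicate)
  open import Data.Nat.ListAction using (sum)
  open IntegerSums

  _at_ : List ℕ → ℕ → ℕ
  []       at i     = 0
  (x ∷ xs) at zero  = x
  (x ∷ xs) at suc i = xs at i

  +sum≡Σℤ-at : ∀ l → + sum l ≡ Σℤ (length l) (λ i → + (l at i))
  +sum≡Σℤ-at []       = refl
  +sum≡Σℤ-at (x ∷ xs) = trans (ℤₚ.pos-+ x (sum xs))
    (trans (cong (λ s → + x ℤ.+ s) (+sum≡Σℤ-at xs)) (sym (Σℤ-suc (length xs) (λ i → + ((x ∷ xs) at i)))))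

  ++-at-< : ∀ (xs ys : List ℕ) i → i < length xs → (xs ++ ys) at i ≡ xs at i
  ++-at-< (x ∷ xs) ys zero    _         = refl
  ++-at-< (x ∷ xs) ys (suc i) (s≤s i<n) = ++-at-< xs ys i i<n

  ∷ʳ-at-length : ∀ (xs : List ℕ) y → (xs ++ [ y ]) at length xs ≡ y
  ∷ʳ-at-length []       y = refl
  ∷ʳ-at-length (x ∷ xs) y = ∷ʳ-at-length xs y

  replicate-++-at-< : ∀ j i (ys : List ℕ) → i < j → (replicate j 0 ++ ys) at i ≡ 0
  replicate-++-at-< (suc j) zero    ys _         = refl
  replicate-++-at-< (suc j) (suc i) ys (s≤s i<j) = replicate-++-at-< j i ys i<j

  replicate-++-at : ∀ j y (ys : List ℕ) → (replicate j 0 ++ y ∷ ys) at j ≡ y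
  replicate-++-at zero    y ys = refl
  replicate-++-at (suc j) y ys = replicate-++-at j y ys

  G-at-window : ∀ k n → G k n ≡ window k n at 0
  G-at-window k n with window k n
  ... | []    = refl
  ... | x ∷ _ = refl

  module _ (k-1 : ℕ) where

    private
      k : ℕ
      k = suc k-1

    length-window : ∀ n → length (window k n) ≡ k
    length-window zero =
      trans (length-++ (replicate k-1 0)) (trans (ℕₚ.+-comm _ 1) (cong suc (length-replicate k-1)))
    length-window (suc n) with window k n | length-window n
    ... | x ∷ xs | |x∷xs|≡k = trans (length-++ xs) (trans (ℕₚ.+-comm (length xs) 1) |x∷xs|≡k)

    window-suc-at : ∀ n i → suc i < k → window k (suc n) at i ≡ window k n at suc i
    window-suc-at n i si<k with window k n | length-window n
    ... | x ∷ xs | |x∷xs|≡k =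
      ++-at-< xs _ i (subst (suc i ≤_) (sym (ℕₚ.suc-injective |x∷xs|≡k)) (ℕₚ.≤-pred si<k))

    window-suc-last : ∀ n → window k (suc n) at k-1 ≡ sum (window k n)
    window-suc-last n with window k n | length-window n
    ... | x ∷ xs | |x∷xs|≡k =
      subst (λ j → (xs ++ [ sum (x ∷ xs) ]) at j ≡ sum (x ∷ xs))
        (ℕₚ.suc-injective |x∷xs|≡k) (∷ʳ-at-length xs _)

    window-at : ∀ n i → i < k → window k n at i ≡ G k (n + i)
    window-at n zero    _    = trans (sym (G-at-window k n)) (cong (G k) (sym (ℕₚ.+-identityʳ n)))
    window-at n (suc i) si<k = begin
      window k n at suc i        ≡⟨ window-suc-at n i si<k ⟨
      window k (suc n) at i      ≡⟨ window-at (suc n) i (ℕₚ.<-trans (ℕₚ.n<1+n i) si<k) ⟩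
      G k (suc n + i)            ≡⟨ cong (G k) (ℕₚ.+-suc n i) ⟨
      G k (n + suc i)            ∎
      where open ≡-Reasoning

    G-recurrence : ∀ n → + G k (n + k) ≡ Σℤ k (λ i → + G k (n + i))
    G-recurrence n = begin
      + G k (n + k)                                 ≡⟨ cong (λ j → + G k j) (ℕₚ.+-suc n k-1) ⟩
      + G k (suc n + k-1)                           ≡⟨ cong +_ (window-at (suc n) k-1 ℕₚ.≤-refl) ⟨
      + (window k (suc n) at k-1)                   ≡⟨ cong +_ (window-suc-last n) ⟩
      + sum (window k n)                            ≡⟨ +sum≡Σℤ-at (window k n) ⟩
      Σℤ (length (window k n)) (λ i → + (window k n at i))
        ≡⟨ cong (λ j → Σℤ j (λ i → + (window k n at i))) (length-window n) ⟩
      Σℤ k (λ i → + (window k n at i))              ≡⟨ Σℤ-cong k (λ i i<k → cong +_ (window-at n i i<k)) ⟩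
      Σℤ k (λ i → + G k (n + i))                    ∎
      where open ≡-Reasoning

    G-initial-zero : ∀ i → i < k-1 → G k i ≡ 0
    G-initial-zero i i<k-1 =
      trans (sym (window-at 0 i (ℕₚ.m<n⇒m<1+n i<k-1))) (replicate-++-at-< k-1 i _ i<k-1)

    G-initial-one : G k k-1 ≡ 1
    G-initial-one = trans (sym (window-at 0 k-1 ℕₚ.≤-refl)) (replicate-++-at k-1 1 [])

module QuadraticForm (c : ℕ) where

  open import Data.Nat as ℕ using (zero; suc; _<_)
  import Data.Nat.Properties as ℕₚ
  open import Data.Integer using (ℤ; +_; -_; _+_; _-_; _*_)
  import Data.Integer.Properties as ℤₚ
  open import Data.Integer.Tactic.RingSolver using (solve-∀)
  open import Relation.Nullary using (yes; no)
  open import Data.Empty using (⊥-elim)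
  open IntegerSums

  k : ℕ
  k = suc (suc c)

  form : ℕ → (ℕ → ℤ) → ℤ
  form n y = Σℤ n (λ i → Σℤ (n ∸ i) (λ t → N k i (i ℕ.+ t) * (y i * y (i ℕ.+ t))))

  column : ℕ → (ℕ → ℤ) → ℤ
  column n y = Σℤ (suc n) (λ i → N k i n * (y i * y n))

  form-suc : ∀ n y → form (suc n) y ≡ form n y + column n y
  form-suc n y = begin
    Σℤ n (λ i → Σℤ (suc n ∸ i) (term i)) + Σℤ (suc n ∸ n) (term n)
      ≡⟨ cong₂ _+_ (Σℤ-cong n row) (trans (cong (λ j → Σℤ j (term n)) (ℕₚ.m+n∸n≡m 1 n)) diagonal) ⟩
    Σℤ n (λ i → Σℤ (n ∸ i) (term i) + entry i) + entry n
      ≡⟨ cong (_+ entry n) (Σℤ-+ n _ entry) ⟩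
    (form n y + Σℤ n entry) + entry n
      ≡⟨ ℤₚ.+-assoc (form n y) _ _ ⟩
    form n y + column n y ∎
    where
    open ≡-Reasoning
    term : ℕ → ℕ → ℤ
    term i t = N k i (i ℕ.+ t) * (y i * y (i ℕ.+ t))
    entry : ℕ → ℤ
    entry i = N k i n * (y i * y n)
    at-n : ∀ i t → i ℕ.+ t ≡ n → term i t ≡ entry i
    at-n i t i+t≡n = cong (λ j → N k i j * (y i * y j)) i+t≡n
    diagonal : Σℤ 1 (term n) ≡ entry n
    diagonal = trans (ℤₚ.+-identityˡ (term n 0)) (at-n n 0 (ℕₚ.+-identityʳ n))
    row : ∀ i → i < n → Σℤ (suc n ∸ i) (term i) ≡ Σℤ (n ∸ i) (term i) + entry i
    row i i<n = trans (cong (λ j → Σℤ j (term i)) (ℕₚ.+-∸-assoc 1 (ℕₚ.<⇒≤ i<n)))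
      (cong (λ e → Σℤ (n ∸ i) (term i) + e) (at-n i (n ∸ i) (ℕₚ.m+[n∸m]≡n (ℕₚ.<⇒≤ i<n))))

  form-cong : ∀ n {y z : ℕ → ℤ} → (∀ i → y i ≡ z i) → form n y ≡ form n z
  form-cong n y≗z = Σℤ-cong n (λ i _ → Σℤ-cong (n ∸ i) (λ t _ →
    cong₂ (λ a b → N k i (i ℕ.+ t) * (a * b)) (y≗z i) (y≗z (i ℕ.+ t))))

  form-supported-last : ∀ n y → (∀ i → i < n → y i ≡ + 0) → form (suc n) y ≡ N k n n * (y n * y n)
  form-supported-last n y y≗0 = begin
    form (suc n) y                                        ≡⟨ form-suc n y ⟩
    form n y + (Σℤ n (λ i → N k i n * (y i * y n)) + N k n n * (y n * y n))
      ≡⟨ cong₂ (λ a b → a + (b + N k n n * (y n * y n))) form-vanishes column-vanishes ⟩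
    + 0 + (+ 0 + N k n n * (y n * y n))                   ≡⟨ ℤₚ.+-identityˡ _ ⟩
    + 0 + N k n n * (y n * y n)                           ≡⟨ ℤₚ.+-identityˡ _ ⟩
    N k n n * (y n * y n)                                 ∎
    where
    open ≡-Reasoning
    killed : ∀ i j → i < n → N k i j * (y i * y j) ≡ + 0
    killed i j i<n = trans (cong (λ a → N k i j * (a * y j)) (y≗0 i i<n)) (ℤₚ.*-zeroʳ (N k i j))
    form-vanishes : form n y ≡ + 0
    form-vanishes = Σℤ-zero n _ (λ i i<n → Σℤ-zero (n ∸ i) _ (λ t _ → killed i (i ℕ.+ t) i<n))
    column-vanishes : Σℤ n (λ i → N k i n * (y i * y n)) ≡ + 0
    column-vanishes = Σℤ-zero n _ (λ i i<n → killed i n i<n)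

  N-offDiagonal : ∀ i j → i < j → N k i j ≡ + 2 * + suc i * (+ j - + c)
  N-offDiagonal zero    (suc j) _   = refl
  N-offDiagonal (suc i) j       i<j with suc i ℕ.≟ j
  ... | yes i≡j = ⊥-elim (ℕₚ.<-irrefl i≡j i<j)
  ... | no  _   = cong (_* (+ j - + c))
    (trans (ℤₚ.pos-* 2 (suc i ℕ.+ 1)) (cong (λ w → + 2 * + w) (ℕₚ.+-comm (suc i) 1)))

  N-diagonal : ∀ i → N k (suc i) (suc i) ≡ + 4 - (+ suc i + + 3) * (+ 2 + + c - + suc i)
  N-diagonal i with suc i ℕ.≟ suc i
  ... | yes _   = refl
  ... | no  i≢i = ⊥-elim (i≢i refl)

  N-diagonal-step : ∀ i → N k (suc i) (suc i) ≡ N k (suc (suc i)) (suc (suc i)) + (+ c - + 2 * + suc (suc i))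
  N-diagonal-step i = trans (N-diagonal i)
    (trans (polynomial (+ i) (+ c)) (cong (_+ (+ c - + 2 * + suc (suc i))) (sym (N-diagonal (suc i)))))
    where
    polynomial : ∀ i c → + 4 - (+ 1 + i + + 3) * (+ 2 + c - (+ 1 + i))
                       ≡ (+ 4 - (+ 2 + i + + 3) * (+ 2 + c - (+ 2 + i))) + (c - + 2 * (+ 2 + i))
    polynomial = solve-∀

  N-last : N k (suc c) (suc c) ≡ - + c
  N-last = trans (N-diagonal c) (polynomial (+ c))
    where
    polynomial : ∀ c → + 4 - (+ 1 + c + + 3) * (+ 2 + c - (+ 1 + c)) ≡ - c
    polynomial = solve-∀

  moment : ℕ → (ℕ → ℤ) → ℤ
  moment n y = Σℤ n (λ i → + i * y i)

  moment-shift : ∀ n y → moment n (λ i → y (suc i)) + Σℤ n (λ i → y (suc i)) ≡ moment (suc n) y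
  moment-shift n y = sym (begin
    moment (suc n) y                                        ≡⟨ Σℤ-suc n (λ i → + i * y i) ⟩
    + 0 + Σℤ n (λ i → + suc i * y (suc i))                  ≡⟨ ℤₚ.+-identityˡ _ ⟩
    Σℤ n (λ i → + suc i * y (suc i))                        ≡⟨ Σℤ-cong n (λ i _ → split (+ i) (y (suc i))) ⟩
    Σℤ n (λ i → + i * y (suc i) + y (suc i))                ≡⟨ Σℤ-+ n _ _ ⟩
    moment n (λ i → y (suc i)) + Σℤ n (λ i → y (suc i))     ∎)
    where
    open ≡-Reasoning
    split : ∀ i x → (+ 1 + i) * x ≡ i * x + x
    split = solve-∀

  column-formula : ∀ n y → column (suc n) y ≡
    + 2 * (+ suc n - + c) * y (suc n) * (moment (suc n) y + Σℤ (suc n) y) + N k (suc n) (suc n) * (y (suc n) * y (suc n))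
  column-formula n y = cong (_+ N k (suc n) (suc n) * (y (suc n) * y (suc n))) (begin
    Σℤ (suc n) (λ i → N k i (suc n) * (y i * y (suc n)))       ≡⟨ Σℤ-cong (suc n) entry ⟩
    Σℤ (suc n) (λ i → a * (+ i * y i + y i))                   ≡⟨ Σℤ-*ˡ (suc n) a _ ⟩
    a * Σℤ (suc n) (λ i → + i * y i + y i)                     ≡⟨ cong (a *_) (Σℤ-+ (suc n) _ y) ⟩
    a * (moment (suc n) y + Σℤ (suc n) y)                      ∎)
    where
    open ≡-Reasoning
    a : ℤ
    a = + 2 * (+ suc n - + c) * y (suc n)
    polynomial : ∀ i j c yᵢ yⱼ → + 2 * (+ 1 + i) * (j - c) * (yᵢ * yⱼ) ≡ + 2 * (j - c) * yⱼ * (i * yᵢ + yᵢ)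
    polynomial = solve-∀
    entry : ∀ i → i < suc n → N k i (suc n) * (y i * y (suc n)) ≡ a * (+ i * y i + y i)
    entry i i<j = trans (cong (_* (y i * y (suc n))) (N-offDiagonal i (suc n) i<j))
      (polynomial (+ i) (+ suc n) (+ c) (y i) (y (suc n)))

  shiftDefect : ℕ → (ℕ → ℤ) → ℤ
  shiftDefect n y = + c * S * S - + 2 * S * M + + 2 * (+ n - + 1 - + c) * y n * M
                  + N k (n ∸ 1) (n ∸ 1) * (y n * y n) + + 2 * (+ 1 + + c) * (y 1 * y 1)
    where
    S M : ℤ
    S = Σℤ n y
    M = moment n y

  form-shift : ∀ p y → form (suc (suc p)) (λ i → y (suc i)) ≡ form (suc (suc p)) y + shiftDefect (suc (suc p)) y
  form-shift zero y = polynomial (+ c) (y 0) (y 1) (y 2)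
    where
    -- Both sides of the goal unfolded literally (including the leading + 0 of each Σℤ), so
    -- that this instance of the identity is the goal up to conversion.
    polynomial : ∀ c y₀ y₁ y₂ →
      let N₁₁ = + 4 - + 4 * (+ 2 + c - + 1)
          form₂ : ℤ → ℤ → ℤ
          form₂ a b = (+ 0 + ((+ 0 + - c * (a * a)) + + 2 * (+ 1 - c) * (a * b))) + (+ 0 + N₁₁ * (b * b))
          S = (+ 0 + y₀) + y₁
          M = (+ 0 + + 0 * y₀) + + 1 * y₁
      in form₂ y₁ y₂ ≡ form₂ y₀ y₁ + (c * S * S - + 2 * S * M + + 2 * (+ 2 - + 1 - c) * y₂ * M
                                      + N₁₁ * (y₂ * y₂) + + 2 * (+ 1 + c) * (y₁ * y₁))
    polynomial = solve-∀
  form-shift (suc p) y =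
    trans (form-suc n y′)
    (trans (cong₂ _+_ (form-shift p y) (column-formula (suc p) y′))
    (trans (polynomial (form n y) (Σℤ n y) (moment n y) (moment n y′ + Σℤ n y′) (y n) (y (suc n)) (y 1)
                       (+ c) (+ n) (N k n n) (N k (suc p) (suc p)) (N-diagonal-step p) (moment-shift n y))
    (cong (_+ shiftDefect (suc n) y)
      (trans (cong (λ e → form n y + e) (sym (column-formula (suc p) y))) (sym (form-suc n y))))))
    where
    n : ℕ
    n = suc (suc p)
    y′ : ℕ → ℤ
    y′ i = y (suc i)
    polynomial : ∀ F S M A′ yₙ yₙ₊₁ y₁ c n Nₙ Nₙ₋₁ → Nₙ₋₁ ≡ Nₙ + (c - + 2 * n) → A′ ≡ M + n * yₙ →
        (F + (c * S * S - + 2 * S * M + + 2 * (n - + 1 - c) * yₙ * M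
              + Nₙ₋₁ * (yₙ * yₙ) + + 2 * (+ 1 + c) * (y₁ * y₁)))
        + (+ 2 * (n - c) * yₙ₊₁ * A′ + Nₙ * (yₙ₊₁ * yₙ₊₁))
      ≡ (F + (+ 2 * (n - c) * yₙ * (M + S) + Nₙ * (yₙ * yₙ)))
        + (c * (S + yₙ) * (S + yₙ) - + 2 * (S + yₙ) * (M + n * yₙ) + + 2 * (+ 1 + n - + 1 - c) * yₙ₊₁ * (M + n * yₙ)
           + Nₙ * (yₙ₊₁ * yₙ₊₁) + + 2 * (+ 1 + c) * (y₁ * y₁))
    polynomial F S M _ yₙ yₙ₊₁ y₁ c n Nₙ _ refl refl = identity F S M yₙ yₙ₊₁ y₁ c n Nₙ
      where
      identity : ∀ F S M yₙ yₙ₊₁ y₁ c n Nₙ →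
          (F + (c * S * S - + 2 * S * M + + 2 * (n - + 1 - c) * yₙ * M
                + (Nₙ + (c - + 2 * n)) * (yₙ * yₙ) + + 2 * (+ 1 + c) * (y₁ * y₁)))
          + (+ 2 * (n - c) * yₙ₊₁ * (M + n * yₙ) + Nₙ * (yₙ₊₁ * yₙ₊₁))
        ≡ (F + (+ 2 * (n - c) * yₙ * (M + S) + Nₙ * (yₙ * yₙ)))
          + (c * (S + yₙ) * (S + yₙ) - + 2 * (S + yₙ) * (M + n * yₙ) + + 2 * (+ 1 + n - + 1 - c) * yₙ₊₁ * (M + n * yₙ)
             + Nₙ * (yₙ₊₁ * yₙ₊₁) + + 2 * (+ 1 + c) * (y₁ * y₁))
      identity = solve-∀

  shiftDefect-recurrent : ∀ y → y k ≡ Σℤ k y → shiftDefect k y ≡ + 2 * (+ 1 + + c) * (y 1 * y 1)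
  shiftDefect-recurrent y yₖ≡S = polynomial (+ c) (Σℤ k y) (moment k y) (y k) (y 1) _ yₖ≡S N-last
    where
    polynomial : ∀ c S M yₖ y₁ Nₖ₋₁ → yₖ ≡ S → Nₖ₋₁ ≡ - c →
      c * S * S - + 2 * S * M + + 2 * (+ 2 + c - + 1 - c) * yₖ * M + Nₖ₋₁ * (yₖ * yₖ) + + 2 * (+ 1 + c) * (y₁ * y₁)
        ≡ + 2 * (+ 1 + c) * (y₁ * y₁)
    polynomial c S M _ y₁ _ refl refl = identity c S M y₁
      where
      identity : ∀ c S M y₁ →
        c * S * S - + 2 * S * M + + 2 * (+ 2 + c - + 1 - c) * S * M + - c * (S * S) + + 2 * (+ 1 + c) * (y₁ * y₁)
          ≡ + 2 * (+ 1 + c) * (y₁ * y₁)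
      identity = solve-∀

module SumOfSquares (c : ℕ) where

  open import Data.Nat as ℕ using (zero; suc; s≤s; z≤n)
  import Data.Nat.Properties as ℕₚ
  open import Data.Integer using (ℤ; +_; _+_; _-_; _*_)
  import Data.Integer.Properties as ℤₚ
  open import Data.Integer.Tactic.RingSolver using (solve-∀)
  open IntegerSums
  open QuadraticForm c
  open KBonacciRecurrence

  windowℤ : ℕ → ℕ → ℤ
  windowℤ m i = + G k (m ℕ.+ i)

  squareSum : ℕ → ℤ
  squareSum m = Σℤ (suc m) (λ i → + (G k i ℕ.* G k i))

  D : ℤ
  D = + (2 ℕ.* suc c)

  form-initial : form k (windowℤ 0) ≡ N k (suc c) (suc c)
  form-initial = begin
    form k (windowℤ 0)                            ≡⟨ form-supported-last (suc c) (windowℤ 0) window₀-vanishes ⟩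
    N k (suc c) (suc c) * (windowℤ 0 (suc c) * windowℤ 0 (suc c))
      ≡⟨ cong (λ g → N k (suc c) (suc c) * (+ g * + g)) (G-initial-one (suc c)) ⟩
    N k (suc c) (suc c) * + 1                     ≡⟨ ℤₚ.*-identityʳ _ ⟩
    N k (suc c) (suc c)                           ∎
    where
    open ≡-Reasoning
    window₀-vanishes : ∀ i → i ℕ.< suc c → windowℤ 0 i ≡ + 0
    window₀-vanishes i i<k-1 = cong +_ (G-initial-zero (suc c) i i<k-1)

  form-step : ∀ m → form k (windowℤ (suc m)) ≡ form k (windowℤ m) + D * + (G k (suc m) ℕ.* G k (suc m))
  form-step m = begin
    form k (windowℤ (suc m))                         ≡⟨ form-cong k (λ i → cong (λ j → + G k j) (sym (ℕₚ.+-suc m i))) ⟩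
    form k (λ i → windowℤ m (suc i))                 ≡⟨ form-shift c (windowℤ m) ⟩
    form k (windowℤ m) + shiftDefect k (windowℤ m)   ≡⟨ cong (λ e → form k (windowℤ m) + e) defect ⟩
    form k (windowℤ m) + D * + (G k (suc m) ℕ.* G k (suc m)) ∎
    where
    open ≡-Reasoning
    defect : shiftDefect k (windowℤ m) ≡ D * + (G k (suc m) ℕ.* G k (suc m))
    defect = trans (shiftDefect-recurrent (windowℤ m) (G-recurrence (suc c) m))
      (cong₂ _*_ (sym (ℤₚ.pos-* 2 (suc c)))
        (trans (cong (λ j → + G k j * + G k j) (ℕₚ.+-comm m 1)) (sym (ℤₚ.pos-* (G k (suc m)) (G k (suc m))))))

  squareSum-identity : ∀ m → D * squareSum m ≡ form k (windowℤ m) - N k (suc c) (suc c)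
  squareSum-identity zero = begin
    D * (+ 0 + + (G k 0 ℕ.* G k 0))               ≡⟨ cong (λ g → D * (+ 0 + + (g ℕ.* g))) (G-initial-zero (suc c) 0 (s≤s z≤n)) ⟩
    D * + 0                                       ≡⟨ ℤₚ.*-zeroʳ D ⟩
    + 0                                           ≡⟨ ℤₚ.+-inverseʳ (N k (suc c) (suc c)) ⟨
    N k (suc c) (suc c) - N k (suc c) (suc c)     ≡⟨ cong (_- N k (suc c) (suc c)) form-initial ⟨
    form k (windowℤ 0) - N k (suc c) (suc c)      ∎
    where open ≡-Reasoning
  squareSum-identity (suc m) = begin
    D * (squareSum m + g)                         ≡⟨ ℤₚ.*-distribˡ-+ D (squareSum m) g ⟩
    D * squareSum m + D * g                       ≡⟨ cong (_+ D * g) (squareSum-identity m) ⟩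
    (form k (windowℤ m) - Nₖ₋₁) + D * g           ≡⟨ regroup (form k (windowℤ m)) Nₖ₋₁ (D * g) ⟩
    (form k (windowℤ m) + D * g) - Nₖ₋₁           ≡⟨ cong (_- Nₖ₋₁) (form-step m) ⟨
    form k (windowℤ (suc m)) - Nₖ₋₁               ∎
    where
    open ≡-Reasoning
    g Nₖ₋₁ : ℤ
    g = + (G k (suc m) ℕ.* G k (suc m))
    Nₖ₋₁ = N k (suc c) (suc c)
    regroup : ∀ a b d → (a - b) + d ≡ (a + d) - b
    regroup = solve-∀

module DivisionByPositive where

  open import Data.Nat using (zero; suc)
  open import Data.Integer as ℤ using (ℤ; +_)
  open import Data.Integer.Tactic.RingSolver using (solve-∀)
  open import Data.Rational using (ℚ; _/_; _+_; _*_; -_; toℚᵘ)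
  open import Data.Rational.Properties
    using (toℚᵘ-injective; toℚᵘ-fromℚᵘ; toℚᵘ-homo-+; toℚᵘ-homo-*; toℚᵘ-homo‿-; 0/n≡0)
  import Data.Rational.Unnormalised as ℚᵘ
  import Data.Rational.Unnormalised.Properties as ℚᵘₚ
  open ℚᵘₚ.≃-Reasoning
  open IntegerSums

  toℚᵘ-/ : ∀ z d → toℚᵘ (z / suc d) ℚᵘ.≃ ℚᵘ.mkℚᵘ z d
  toℚᵘ-/ z d = toℚᵘ-fromℚᵘ (ℚᵘ.mkℚᵘ z d)

  /-distribʳ-+ : ∀ a b d → (a ℤ.+ b) / suc d ≡ a / suc d + b / suc d
  /-distribʳ-+ a b d = toℚᵘ-injective (begin
    toℚᵘ ((a ℤ.+ b) / suc d)                ≈⟨ toℚᵘ-/ (a ℤ.+ b) d ⟩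
    ℚᵘ.mkℚᵘ (a ℤ.+ b) d                     ≈⟨ ℚᵘ.*≡* (cross a b (+ suc d)) ⟩
    ℚᵘ.mkℚᵘ a d ℚᵘ.+ ℚᵘ.mkℚᵘ b d            ≈⟨ ℚᵘₚ.+-cong (toℚᵘ-/ a d) (toℚᵘ-/ b d) ⟨
    toℚᵘ (a / suc d) ℚᵘ.+ toℚᵘ (b / suc d)  ≈⟨ toℚᵘ-homo-+ (a / suc d) (b / suc d) ⟨
    toℚᵘ (a / suc d + b / suc d)            ∎)
    where
    cross : ∀ a b s → (a ℤ.+ b) ℤ.* (s ℤ.* s) ≡ (a ℤ.* s ℤ.+ b ℤ.* s) ℤ.* s
    cross = solve-∀

  neg-/ : ∀ a d → (ℤ.- a) / suc d ≡ - (a / suc d)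
  neg-/ a d = toℚᵘ-injective (begin
    toℚᵘ ((ℤ.- a) / suc d)    ≈⟨ toℚᵘ-/ (ℤ.- a) d ⟩
    ℚᵘ.- ℚᵘ.mkℚᵘ a d          ≈⟨ ℚᵘₚ.-‿cong (toℚᵘ-/ a d) ⟨
    ℚᵘ.- toℚᵘ (a / suc d)     ≈⟨ toℚᵘ-homo‿- (a / suc d) ⟨
    toℚᵘ (- (a / suc d))      ∎)

  /-*-/1 : ∀ a b d → (a / suc d) * (b / 1) ≡ (a ℤ.* b) / suc d
  /-*-/1 a b d = toℚᵘ-injective (begin
    toℚᵘ ((a / suc d) * (b / 1))            ≈⟨ toℚᵘ-homo-* (a / suc d) (b / 1) ⟩
    toℚᵘ (a / suc d) ℚᵘ.* toℚᵘ (b / 1)      ≈⟨ ℚᵘₚ.*-cong (toℚᵘ-/ a d) (toℚᵘ-/ b 0) ⟩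
    ℚᵘ.mkℚᵘ a d ℚᵘ.* ℚᵘ.mkℚᵘ b 0            ≈⟨ ℚᵘ.*≡* (cross (a ℤ.* b) (+ suc d)) ⟩
    ℚᵘ.mkℚᵘ (a ℤ.* b) d                     ≈⟨ toℚᵘ-/ (a ℤ.* b) d ⟨
    toℚᵘ ((a ℤ.* b) / suc d)                ∎)
    where
    cross : ∀ x s → x ℤ.* s ≡ x ℤ.* (s ℤ.* + 1)
    cross = solve-∀

  /1-rescale : ∀ a d → a / 1 ≡ (+ suc d ℤ.* a) / suc d
  /1-rescale a d = toℚᵘ-injective (begin
    toℚᵘ (a / 1)                        ≈⟨ toℚᵘ-/ a 0 ⟩
    ℚᵘ.mkℚᵘ a 0                         ≈⟨ ℚᵘ.*≡* (cross a (+ suc d)) ⟩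
    ℚᵘ.mkℚᵘ (+ suc d ℤ.* a) d           ≈⟨ toℚᵘ-/ (+ suc d ℤ.* a) d ⟨
    toℚᵘ ((+ suc d ℤ.* a) / suc d)      ∎)
    where
    cross : ∀ a s → a ℤ.* s ≡ (s ℤ.* a) ℤ.* + 1
    cross = solve-∀

  Σ<-cong : ∀ n {f g : ℕ → ℚ} → (∀ i → f i ≡ g i) → Σ< n f ≡ Σ< n g
  Σ<-cong zero    f≗g = refl
  Σ<-cong (suc n) f≗g = cong₂ _+_ (Σ<-cong n f≗g) (f≗g n)

  Σ<-/ : ∀ n (f : ℕ → ℤ) d → Σ< n (λ i → f i / suc d) ≡ Σℤ n f / suc d
  Σ<-/ zero    f d = sym (0/n≡0 (suc d))
  Σ<-/ (suc n) f d = trans (cong (_+ f n / suc d) (Σ<-/ n f d)) (sym (/-distribʳ-+ (Σℤ n f) (f n) d))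

open import Data.Nat using (zero; suc; s≤s)
import Data.Nat as ℕ
open import Data.Integer as ℤ using (+_)
import Data.Integer.Properties as ℤₚ
open import Data.Rational using (_/_; _+_; _*_; _-_)
open DivisionByPositive

module _ (c : ℕ) where

  open QuadraticForm c
  open SumOfSquares c

  doubleSum≡form/D : ∀ m → doubleSum k m ≡ form k (windowℤ m) / (2 ℕ.* suc c)
  doubleSum≡form/D m = trans (Σ<-cong k (λ i → trans (Σ<-cong (k ∸ i) (entry i)) (Σ<-/ (k ∸ i) _ _))) (Σ<-/ k _ _)
    where
    entry : ∀ i t → divD k (N k i (i ℕ.+ t)) * ((+ (G k (m ℕ.+ i) ℕ.* G k (m ℕ.+ (i ℕ.+ t)))) / 1)
                  ≡ (N k i (i ℕ.+ t) ℤ.* (windowℤ m i ℤ.* windowℤ m (i ℕ.+ t))) / (2 ℕ.* suc c)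
    entry i t = trans (/-*-/1 (N k i (i ℕ.+ t)) _ _) (cong (λ z → (N k i (i ℕ.+ t) ℤ.* z) / (2 ℕ.* suc c))
      (ℤₚ.pos-* (G k (m ℕ.+ i)) (G k (m ℕ.+ (i ℕ.+ t)))))

mainTheorem1 : (k : ℕ) → 2 ≤ k → (m : ℕ) →
    sumSq k m ≡ doubleSum k m - divD k (N k (k ∸ 1) (k ∸ 1))
mainTheorem1 zero          ()          m
mainTheorem1 (suc zero)    (s≤s ())    m
mainTheorem1 (suc (suc c)) _           m = begin
  sumSq k m                             ≡⟨ Σ<-/ (suc m) _ 0 ⟩
  squareSum m / 1                       ≡⟨ /1-rescale (squareSum m) _ ⟩
  (D ℤ.* squareSum m) / d               ≡⟨ cong (_/ d) (squareSum-identity m) ⟩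
  (F ℤ.- Nₖ₋₁) / d                      ≡⟨ /-distribʳ-+ F (ℤ.- Nₖ₋₁) _ ⟩
  F / d + (ℤ.- Nₖ₋₁) / d                ≡⟨ cong (λ q → F / d + q) (neg-/ Nₖ₋₁ _) ⟩
  F / d - divD k Nₖ₋₁                   ≡⟨ cong (_- divD k Nₖ₋₁) (doubleSum≡form/D c m) ⟨
  doubleSum k m - divD k Nₖ₋₁           ∎
  where
  open ≡-Reasoning
  open QuadraticForm c
  open SumOfSquares c
  d : ℕ
  d = 2 ℕ.* suc c
  F Nₖ₋₁ : ℤ.ℤ
  F = form k (windowℤ m)
  Nₖ₋₁ = N k (suc c) (suc c)
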